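{- Let $\Gamma,\Delta$ be finite multisets of formulas and $A$ a formula. If the focused sequent $\Gamma\vdash .;\Delta$ (resp. $\Gamma\vdash A;\Delta$) has a proof in the focused classical sequent calculus, then the sequent $\Gamma\vdash\Delta$ (resp. $\Gamma\vdash A,\Delta$) has a proof in the cut-free classical sequent calculus.
   Context: Formulas are first-order formulas built from atomic formulas with $\wedge,\vee,\Rightarrow,\neg,\forall,\exists$. The cut-free classical sequent calculus on sequents $\Gamma\vdash\Delta$ (finite multisets) has: axiom $\Gamma,A\vdash A,\Delta$; the usual left and right rules for $\wedge,\vee,\Rightarrow,\neg,\forall,\exists$ (with $\vee_R$: from $\Gamma\vdash A,B,\Delta$ infer $\Gamma\vdash A\vee B,\Delta$; $\Rightarrow_L$: from $\Gamma\vdash A,\Delta$ and $\Gamma,B\vdash\Delta$ infer $\Gamma,A\Rightarrow B\vdash\Delta$; fresh constant in $\forall_R,\exists_L$, arbitrary term in $\forall_L,\exists_R$); contraction and weakening on both sides; no cut. A focused sequent is $\Gamma\vdash S;\Delta$ where $\Gamma,\Delta$ are finite multisets and the stoup $S$ is either one formula $A$ (written $\Gamma\vdash A;\Delta$) or empty (written $\Gamma\vdash .;\Delta$). The focused classical sequent calculus has the rules: ax: $\Gamma,A\vdash .;A,\Delta$ with $A$ atomic; $\wedge_L$: from $\Gamma,A,B\vdash .;\Delta$ infer $\Gamma,A\wedge B\vdash .;\Delta$; $\wedge_R$: from $\Gamma\vdash A;\Delta$ and $\Gamma\vdash B;\Delta$ infer $\Gamma\vdash A\wedge B;\Delta$;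 $\vee_L$: from $\Gamma,A\vdash .;\Delta$ and $\Gamma,B\vdash .;\Delta$ infer $\Gamma,A\vee B\vdash .;\Delta$; $\vee_R$: from $\Gamma\vdash .;A,B,\Delta$ infer $\Gamma\vdash .;A\vee B,\Delta$; $\Rightarrow_L$: from $\Gamma\vdash A;\Delta$ and $\Gamma,B\vdash .;\Delta$ infer $\Gamma,A\Rightarrow B\vdash .;\Delta$; $\Rightarrow_R$: from $\Gamma,A\vdash B;\Delta$ infer $\Gamma\vdash A\Rightarrow B;\Delta$; $\neg_L$: from $\Gamma\vdash A;\Delta$ infer $\Gamma,\neg A\vdash .;\Delta$; $\neg_R$: from $\Gamma,A\vdash .;\Delta$ infer $\Gamma\vdash .;\neg A,\Delta$; $\exists_L$: from $\Gamma,A[c/x]\vdash .;\Delta$ infer $\Gamma,\exists xA\vdash .;\Delta$; $\exists_R$: from $\Gamma\vdash .;A[t/x],\Delta$ infer $\Gamma\vdash .;\exists xA,\Delta$; $\forall_L$: from $\Gamma,A[t/x]\vdash .;\Delta$ infer $\Gamma,\forall xA\vdash .;\Delta$; $\forall_R$: from $\Gamma\vdash A[c/x];\Delta$ infer $\Gamma\vdash\forall xA;\Delta$; contr$_L$: from $\Gamma,A,A\vdash .;\Delta$ infer $\Gamma,A\vdash .;\Delta$; contr$_R$: from $\Gamma\vdash .;A,A,\Delta$ infer $\Gamma\vdash .;A,\Delta$; weak$_L$: from $\Gamma\vdash .;\Delta$ infer $\Gamma,A\vdash .;\Delta$; weak$_R$: from $\Gamma\vdash .;\Delta$ infer $\Gamma\vdash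 A;\Delta$; focus: from $\Gamma\vdash A;\Delta$ infer $\Gamma\vdash .;A,\Delta$, provided $A$ is neither atomic nor of the form $\exists xB$, $B\vee C$, $\neg B$; release: from $\Gamma\vdash .;A,\Delta$ infer $\Gamma\vdash A;\Delta$, provided $A$ is atomic or of the form $\exists xB$, $B\vee C$ or $\neg B$. In $\forall_R$ and $\exists_L$, $c$ is a fresh constant; in $\forall_L$ and $\exists_R$, $t$ is any term. -}

module Defs where

open import Data.Nat using (ℕ; zero; suc)
open import Data.Fin using (Fin; zero; suc)
open import Data.List using (List; []; _∷_)
open import Data.List.Relation.Unary.All using (All)
open import Data.List.Relation.Binary.Permutation.Propositional using (_↭_)
open import Data.Maybe using (Maybe; just; nothing)
import Data.Maybe as Maybe
open import Data.Product using (_×_)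
open import Data.Unit using (⊤)
open import Relation.Binary.PropositionalEquality using (_≢_)
open import Relation.Nullary using (¬_)

-- A term/formula of type  Term n / Formula n  may mention the bound
-- variables  var 0 … var (n-1);  var zero is the innermost binder.
-- Function/predicate symbols are named by natural numbers; constants are
-- 0-ary function symbols  fun c [].

data Term (n : ℕ) : Set where
  var : Fin n → Term n
  fun : ℕ → List (Term n) → Term n

cst : ∀ {n} → ℕ → Term n
cst c = fun c []

data Formula (n : ℕ) : Set where
  atom : ℕ → List (Term n) → Formula n
  and  : Formula n → Formula n → Formula n
  or   : Formula n → Formula n → Formula n
  imp  : Formula n → Formula n → Formula n
  neg  : Formula n → Formula n
  all  : Formula (suc n) → Formula n
  ex   : Formula (suc n) → Formula n

Form : Set
Form = Formula 0

thick : ∀ {n} → Fin (suc n) → Fin (suc n) → Maybe (Fin n)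
thick zero zero = nothing
thick zero (suc j) = just j
thick {suc n} (suc i) zero = just zero
thick {suc n} (suc i) (suc j) = Maybe.map suc (thick i j)
thick {zero} (suc ()) _

mutual
  liftT : ∀ {n} → Term 0 → Term n
  liftT (fun f ts) = fun f (liftTs ts)

  liftTs : ∀ {n} → List (Term 0) → List (Term n)
  liftTs [] = []
  liftTs (t ∷ ts) = liftT t ∷ liftTs ts

mutual
  substT : ∀ {n} → Fin (suc n) → Term 0 → Term (suc n) → Term n
  substT k t (var i) with thick k i
  ... | nothing = liftT t
  ... | just j  = var j
  substT k t (fun f ts) = fun f (substTs k t ts)

  substTs : ∀ {n} → Fin (suc n) → Term 0 → List (Term (suc n)) → List (Term n)
  substTs k t [] = []
  substTs k t (u ∷ us) = substT k t u ∷ substTs k t us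

substF : ∀ {n} → Fin (suc n) → Term 0 → Formula (suc n) → Formula n
substF k t (atom p ts) = atom p (substTs k t ts)
substF k t (and A B) = and (substF k t A) (substF k t B)
substF k t (or A B)  = or (substF k t A) (substF k t B)
substF k t (imp A B) = imp (substF k t A) (substF k t B)
substF k t (neg A)   = neg (substF k t A)
substF k t (all A)   = all (substF (suc k) t A)
substF k t (ex A)    = ex (substF (suc k) t A)

_[_] : Formula 1 → Term 0 → Form
A [ t ] = substF zero t A

mutual
  FreshT : ∀ {n} → ℕ → Term n → Set
  FreshT c (var i) = ⊤
  FreshT c (fun f ts) = (f ≢ c) × FreshTs c ts

  FreshTs : ∀ {n} → ℕ → List (Term n) → Set
  FreshTs c [] = ⊤
  FreshTs c (t ∷ ts) = FreshT c t × FreshTs c ts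

FreshF : ∀ {n} → ℕ → Formula n → Set
FreshF c (atom p ts) = FreshTs c ts
FreshF c (and A B) = FreshF c A × FreshF c B
FreshF c (or A B)  = FreshF c A × FreshF c B
FreshF c (imp A B) = FreshF c A × FreshF c B
FreshF c (neg A)   = FreshF c A
FreshF c (all A)   = FreshF c A
FreshF c (ex A)    = FreshF c A

FreshL : ℕ → List Form → Set
FreshL c Γ = All (FreshF c) Γ

-- Cut-free classical sequent calculus  Γ ⊢ Δ.
-- Multisets are lists; the exchange rule  exch  identifies lists up to
-- permutation.

infix 3 _⊢_

data _⊢_ : List Form → List Form → Set where
  ax     : ∀ {Γ Δ A} → A ∷ Γ ⊢ A ∷ Δ
  andL   : ∀ {Γ Δ A B} → A ∷ B ∷ Γ ⊢ Δ → and A B ∷ Γ ⊢ Δ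
  andR   : ∀ {Γ Δ A B} → Γ ⊢ A ∷ Δ → Γ ⊢ B ∷ Δ → Γ ⊢ and A B ∷ Δ
  orL    : ∀ {Γ Δ A B} → A ∷ Γ ⊢ Δ → B ∷ Γ ⊢ Δ → or A B ∷ Γ ⊢ Δ
  orR    : ∀ {Γ Δ A B} → Γ ⊢ A ∷ B ∷ Δ → Γ ⊢ or A B ∷ Δ
  impL   : ∀ {Γ Δ A B} → Γ ⊢ A ∷ Δ → B ∷ Γ ⊢ Δ → imp A B ∷ Γ ⊢ Δ
  impR   : ∀ {Γ Δ A B} → A ∷ Γ ⊢ B ∷ Δ → Γ ⊢ imp A B ∷ Δ
  negL   : ∀ {Γ Δ A} → Γ ⊢ A ∷ Δ → neg A ∷ Γ ⊢ Δ
  negR   : ∀ {Γ Δ A} → A ∷ Γ ⊢ Δ → Γ ⊢ neg A ∷ Δ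
  allL   : ∀ {Γ Δ A} (t : Term 0) → A [ t ] ∷ Γ ⊢ Δ → all A ∷ Γ ⊢ Δ
  allR   : ∀ {Γ Δ A} (c : ℕ) → FreshL c Γ → FreshL c Δ → FreshF c A →
           Γ ⊢ A [ cst c ] ∷ Δ → Γ ⊢ all A ∷ Δ
  exL    : ∀ {Γ Δ A} (c : ℕ) → FreshL c Γ → FreshL c Δ → FreshF c A →
           A [ cst c ] ∷ Γ ⊢ Δ → ex A ∷ Γ ⊢ Δ
  exR    : ∀ {Γ Δ A} (t : Term 0) → Γ ⊢ A [ t ] ∷ Δ → Γ ⊢ ex A ∷ Δ
  contrL : ∀ {Γ Δ A} → A ∷ A ∷ Γ ⊢ Δ → A ∷ Γ ⊢ Δ
  contrR : ∀ {Γ Δ A} → Γ ⊢ A ∷ A ∷ Δ → Γ ⊢ A ∷ Δ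
  weakL  : ∀ {Γ Δ A} → Γ ⊢ Δ → A ∷ Γ ⊢ Δ
  weakR  : ∀ {Γ Δ A} → Γ ⊢ Δ → Γ ⊢ A ∷ Δ
  exch   : ∀ {Γ Γ' Δ Δ'} → Γ ↭ Γ' → Δ ↭ Δ' → Γ ⊢ Δ → Γ' ⊢ Δ'

-- Focused classical sequent calculus  Γ ⊢ S ; Δ,
-- stoup S : Maybe Form  (nothing = empty stoup ".").

data Releasable : Form → Set where
  r-atom : ∀ {p ts} → Releasable (atom p ts)
  r-ex   : ∀ {A} → Releasable (ex A)
  r-or   : ∀ {A B} → Releasable (or A B)
  r-neg  : ∀ {A} → Releasable (neg A)

data IsAtomic : Form → Set where
  is-atom : ∀ {p ts} → IsAtomic (atom p ts)

infix 3 _⊢_⨾_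

data _⊢_⨾_ : List Form → Maybe Form → List Form → Set where
  ax      : ∀ {Γ Δ A} → IsAtomic A → A ∷ Γ ⊢ nothing ⨾ A ∷ Δ
  andL    : ∀ {Γ Δ A B} → A ∷ B ∷ Γ ⊢ nothing ⨾ Δ → and A B ∷ Γ ⊢ nothing ⨾ Δ
  andR    : ∀ {Γ Δ A B} → Γ ⊢ just A ⨾ Δ → Γ ⊢ just B ⨾ Δ → Γ ⊢ just (and A B) ⨾ Δ
  orL     : ∀ {Γ Δ A B} → A ∷ Γ ⊢ nothing ⨾ Δ → B ∷ Γ ⊢ nothing ⨾ Δ → or A B ∷ Γ ⊢ nothing ⨾ Δ
  orR     : ∀ {Γ Δ A B} → Γ ⊢ nothing ⨾ A ∷ B ∷ Δ → Γ ⊢ nothing ⨾ or A B ∷ Δ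
  impL    : ∀ {Γ Δ A B} → Γ ⊢ just A ⨾ Δ → B ∷ Γ ⊢ nothing ⨾ Δ → imp A B ∷ Γ ⊢ nothing ⨾ Δ
  impR    : ∀ {Γ Δ A B} → A ∷ Γ ⊢ just B ⨾ Δ → Γ ⊢ just (imp A B) ⨾ Δ
  negL    : ∀ {Γ Δ A} → Γ ⊢ just A ⨾ Δ → neg A ∷ Γ ⊢ nothing ⨾ Δ
  negR    : ∀ {Γ Δ A} → A ∷ Γ ⊢ nothing ⨾ Δ → Γ ⊢ nothing ⨾ neg A ∷ Δ
  exL     : ∀ {Γ Δ A} (c : ℕ) → FreshL c Γ → FreshL c Δ → FreshF c A →
            A [ cst c ] ∷ Γ ⊢ nothing ⨾ Δ → ex A ∷ Γ ⊢ nothing ⨾ Δ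
  exR     : ∀ {Γ Δ A} (t : Term 0) → Γ ⊢ nothing ⨾ A [ t ] ∷ Δ → Γ ⊢ nothing ⨾ ex A ∷ Δ
  allL    : ∀ {Γ Δ A} (t : Term 0) → A [ t ] ∷ Γ ⊢ nothing ⨾ Δ → all A ∷ Γ ⊢ nothing ⨾ Δ
  allR    : ∀ {Γ Δ A} (c : ℕ) → FreshL c Γ → FreshL c Δ → FreshF c A →
            Γ ⊢ just (A [ cst c ]) ⨾ Δ → Γ ⊢ just (all A) ⨾ Δ
  contrL  : ∀ {Γ Δ A} → A ∷ A ∷ Γ ⊢ nothing ⨾ Δ → A ∷ Γ ⊢ nothing ⨾ Δ
  contrR  : ∀ {Γ Δ A} → Γ ⊢ nothing ⨾ A ∷ A ∷ Δ → Γ ⊢ nothing ⨾ A ∷ Δ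
  weakL   : ∀ {Γ Δ A} → Γ ⊢ nothing ⨾ Δ → A ∷ Γ ⊢ nothing ⨾ Δ
  weakR   : ∀ {Γ Δ A} → Γ ⊢ nothing ⨾ Δ → Γ ⊢ just A ⨾ Δ
  focus   : ∀ {Γ Δ A} → ¬ Releasable A → Γ ⊢ just A ⨾ Δ → Γ ⊢ nothing ⨾ A ∷ Δ
  release : ∀ {Γ Δ A} → Releasable A → Γ ⊢ nothing ⨾ A ∷ Δ → Γ ⊢ just A ⨾ Δ
  exch    : ∀ {Γ Γ' Δ Δ' S} → Γ ↭ Γ' → Δ ↭ Δ' → Γ ⊢ S ⨾ Δ → Γ' ⊢ S ⨾ Δ'

module Submission where

-- The stoup is just a distinguished position on the right: reading a
-- focused sequent  Γ ⊢ S ; Δ  as the ordinary sequent  Γ ⊢ S, Δ  (the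
-- stoup formula, if any, placed in front of Δ) turns every focused rule
-- into an instance of the corresponding cut-free rule.  The only rules
-- without a counterpart, focus and release, merely move a formula between
-- the stoup and the head of Δ, so under this reading their premise and
-- conclusion coincide and they disappear.  Exchange on Δ lifts to
-- exchange on  S, Δ  because prepending a formula preserves permutations.

open import Defs
open import Data.List using (List; _∷_)
open import Data.Maybe using (Maybe; just; nothing)
open import Data.Product using (_×_; _,_)
open import Data.List.Relation.Binary.Permutation.Propositional using (_↭_; prep)

withStoup : Maybe Form → List Form → List Form
withStoup nothing  Δ = Δ
withStoup (just A) Δ = A ∷ Δ

withStoup-↭ : ∀ S {Δ Δ'} → Δ ↭ Δ' → withStoup S Δ ↭ withStoup S Δ'
withStoup-↭ nothing  Δ↭Δ' = Δ↭Δ'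
withStoup-↭ (just A) Δ↭Δ' = prep A Δ↭Δ'

unfocus : ∀ {Γ S Δ} → Γ ⊢ S ⨾ Δ → Γ ⊢ withStoup S Δ
unfocus (ax _)                 = ax
unfocus (andL d)               = andL (unfocus d)
unfocus (andR d e)             = andR (unfocus d) (unfocus e)
unfocus (orL d e)              = orL (unfocus d) (unfocus e)
unfocus (orR d)                = orR (unfocus d)
unfocus (impL d e)             = impL (unfocus d) (unfocus e)
unfocus (impR d)               = impR (unfocus d)
unfocus (negL d)               = negL (unfocus d)
unfocus (negR d)               = negR (unfocus d)
unfocus (exL c fΓ fΔ fA d)     = exL c fΓ fΔ fA (unfocus d)
unfocus (exR t d)              = exR t (unfocus d)
unfocus (allL t d)             = allL t (unfocus d)
unfocus (allR c fΓ fΔ fA d)    = allR c fΓ fΔ fA (unfocus d)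
unfocus (contrL d)             = contrL (unfocus d)
unfocus (contrR d)             = contrR (unfocus d)
unfocus (weakL d)              = weakL (unfocus d)
unfocus (weakR d)              = weakR (unfocus d)
unfocus (focus _ d)            = unfocus d
unfocus (release _ d)          = unfocus d
unfocus (exch {S = S} Γ↭Γ' Δ↭Δ' d) = exch Γ↭Γ' (withStoup-↭ S Δ↭Δ') (unfocus d)

proposition1 : (Γ Δ : List Form) →
    ((Γ ⊢ nothing ⨾ Δ) → (Γ ⊢ Δ)) × ((A : Form) → (Γ ⊢ just A ⨾ Δ) → (Γ ⊢ A ∷ Δ))
proposition1 Γ Δ = unfocus , λ A → unfocus
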